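{- For every pair of tailless proofs $\pi_1$ and $\pi_2$ in $\mathcal{G}$, every proof belonging to the class $\mathcal{C}(\pi_1,\pi_2)$ can be transformed into a W-normal proof of the same end sequent and of the same degree.
   Context: Formulae are built from propositional variables and $\bot$ with the binary connectives $\wedge,\vee,\rightarrow$. Sequents have the form $\Gamma \vdash C$, $\Gamma$ a finite (possibly empty) sequence of formulae, $C$ a formula. The system $\mathcal{G}$ has axioms $A \vdash A$ and $\bot \vdash A$ and rules: (C) from $\Delta, A, B, \Gamma \vdash C$ infer $\Delta, B, A, \Gamma \vdash C$; (W) from $\Theta, A, A, \Gamma \vdash C$ infer $\Theta, A, \Gamma \vdash C$; (K) from $\Theta, \Gamma \vdash C$ infer $\Theta, A, \Gamma \vdash C$; (cut) from $\Delta \vdash A$ and $\Theta, A, \Gamma \vdash C$ infer $\Theta, \Delta, \Gamma \vdash C$ ($A$ is the cut formula); ($\wedge$L) from $\Theta, A, \Gamma \vdash C$ (resp. $\Theta, B, \Gamma \vdash C$) infer $\Theta, A\wedge B, \Gamma \vdash C$; ($\wedge$R) from $\Gamma \vdash A$ and $\Gamma \vdash B$ infer $\Gamma \vdash A \wedge B$; ($\vee$L) from $\Theta, A, \Gamma \vdash C$ and $\Theta, B, \Gamma \vdash C$ infer $\Theta, A \vee B, \Gamma \vdash C$; ($\vee$R) from $\Gamma \vdash A$ (resp. $\Gamma \vdash B$) infer $\Gamma \vdash A \vee B$; ($\rightarrow$L) from $\Delta \vdash A$ and $\Theta, B, \Gamma \vdash C$ infer $\Theta, \Delta, A \rightarrow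 B, \Gamma \vdash C$; ($\rightarrow$R) from $A, \Gamma \vdash B$ infer $\Gamma \vdash A \rightarrow B$. The degree of a cut is the number of binary connectives in its cut formula; the degree of a proof is the maximal degree of its cuts (0 if none). Clusters: in each inference, each occurrence of a formula in the antecedent of the conclusion lying in a context sequence ($\Theta,\Delta,\Gamma$ of the schema) has as immediate ancestors the occurrences at the corresponding place in the premise(s); in (C) the displayed $B,A$ of the conclusion have as immediate ancestors the displayed $B$, $A$ of the premise; in (W) the displayed contracted occurrence of $A$ in the conclusion has both displayed occurrences of $A$ of the premise as immediate ancestors. The cluster of an occurrence $G$ is the set of occurrences obtained from $G$ by iterating the immediate-ancestor relation (including $G$). A proof is W-normal iff every application of (W) in it either is the last rule of the proof, or has only applications of (W) below it, or is the upper rule in one of the two contexts: (i) $\Theta, A, A, A, \Gamma \vdash C$ by (W) to $\Theta, A, A, \Gamma \vdash C$ followed by (W) to $\Theta, A, \Gamma \vdash C$; (ii) $A, A, \Gamma \vdash B$ by (W) to $A, \Gamma \vdash B$ followed by ($\rightarrow$R) to $\Gamma \vdash A \rightarrow B$. A W-normal proof is tailless iff its last rule is not (W). For tailless $\pi_1,\pi_2$, the class $\mathcal{C}(\pi_1,\pi_2)$ is defined inductively: (i) $\pi_2 \in \mathcal{C}(\pi_1,\pi_2)$; (ii) if $\pi \in \mathcal{C}(\pi_1,\pi_2)$, then the proof consisting of a cut with left premise proved by $\pi_1$ and right premise proved by $\pi$, with conclusion $\Phi \vdash B$, followed by applications of (C) ending in $\Psi \vdash B$, belongs to $\mathcal{C}(\pi_1,\pi_2)$,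 provided no occurrence of a formula in a subproof $\pi_1$ of $\pi$ belongs to the cluster of the cut formula in the right premise of this cut; (iii) if $\pi \in \mathcal{C}(\pi_1,\pi_2)$, then $\pi$ followed by an application of (W) belongs to $\mathcal{C}(\pi_1,\pi_2)$. -}

module Defs where

open import Data.Nat using (ℕ; zero; suc; _+_; _∸_; _⊔_; _<ᵇ_; _≡ᵇ_)
open import Data.Bool using (Bool; true; false; if_then_else_; T)
open import Data.List using (List; []; _∷_; _++_; [_]; length)
open import Data.List.Membership.Propositional using (_∈_)
open import Data.Maybe using (Maybe; just; nothing)
open import Data.Product using (Σ; _×_; _,_; ∃; ∃-syntax)
open import Data.Sum using (_⊎_)
open import Relation.Nullary using (¬_)
open import Relation.Binary.PropositionalEquality using (_≡_; _≢_)
open import Relation.Binary.Construct.Closure.ReflexiveTransitive using (Star)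

infixr 8 _∧_
infixr 7 _∨_
infixr 6 _⇒_

data Form : Set where
  var : ℕ → Form
  ⊥f  : Form
  _∧_ _∨_ _⇒_ : Form → Form → Form

size : Form → ℕ
size (var _) = 0
size ⊥f = 0
size (A ∧ B) = suc (size A + size B)
size (A ∨ B) = suc (size A + size B)
size (A ⇒ B) = suc (size A + size B)

infix 2 _⊢_

data _⊢_ : List Form → Form → Set where
  ax    : ∀ A → [ A ] ⊢ A
  exf   : ∀ A → [ ⊥f ] ⊢ A
  exch  : ∀ Δ Γ A B {C} → Δ ++ A ∷ B ∷ Γ ⊢ C → Δ ++ B ∷ A ∷ Γ ⊢ C
  contr : ∀ Θ Γ A {C} → Θ ++ A ∷ A ∷ Γ ⊢ C → Θ ++ A ∷ Γ ⊢ C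
  weak  : ∀ Θ Γ A {C} → Θ ++ Γ ⊢ C → Θ ++ A ∷ Γ ⊢ C
  cut   : ∀ Θ Δ Γ A {C} → Δ ⊢ A → Θ ++ A ∷ Γ ⊢ C → Θ ++ Δ ++ Γ ⊢ C
  ∧L₁   : ∀ Θ Γ A B {C} → Θ ++ A ∷ Γ ⊢ C → Θ ++ (A ∧ B) ∷ Γ ⊢ C
  ∧L₂   : ∀ Θ Γ A B {C} → Θ ++ B ∷ Γ ⊢ C → Θ ++ (A ∧ B) ∷ Γ ⊢ C
  ∧R    : ∀ {Γ} A B → Γ ⊢ A → Γ ⊢ B → Γ ⊢ A ∧ B
  ∨L    : ∀ Θ Γ A B {C} → Θ ++ A ∷ Γ ⊢ C → Θ ++ B ∷ Γ ⊢ C → Θ ++ (A ∨ B) ∷ Γ ⊢ C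
  ∨R₁   : ∀ {Γ} A B → Γ ⊢ A → Γ ⊢ A ∨ B
  ∨R₂   : ∀ {Γ} A B → Γ ⊢ B → Γ ⊢ A ∨ B
  ⇒L    : ∀ Θ Δ Γ A B {C} → Δ ⊢ A → Θ ++ B ∷ Γ ⊢ C → Θ ++ Δ ++ (A ⇒ B) ∷ Γ ⊢ C
  ⇒R    : ∀ Γ A B → A ∷ Γ ⊢ B → Γ ⊢ A ⇒ B

record Proof : Set where
  constructor pf
  field
    {ant} : List Form
    {con} : Form
    der   : ant ⊢ con
open Proof public

degree : ∀ {Γ C} → Γ ⊢ C → ℕ
degree (ax A) = 0
degree (exf A) = 0
degree (exch Δ Γ A B d) = degree d
degree (contr Θ Γ A d) = degree d
degree (weak Θ Γ A d) = degree d
degree (cut Θ Δ Γ A d₁ d₂) = size A ⊔ degree d₁ ⊔ degree d₂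
degree (∧L₁ Θ Γ A B d) = degree d
degree (∧L₂ Θ Γ A B d) = degree d
degree (∧R A B d₁ d₂) = degree d₁ ⊔ degree d₂
degree (∨L Θ Γ A B d₁ d₂) = degree d₁ ⊔ degree d₂
degree (∨R₁ A B d) = degree d
degree (∨R₂ A B d) = degree d
degree (⇒L Θ Δ Γ A B d₁ d₂) = degree d₁ ⊔ degree d₂
degree (⇒R Γ A B d) = degree d

premises : ∀ {Γ C} → Γ ⊢ C → List Proof
premises (ax A) = []
premises (exf A) = []
premises (exch Δ Γ A B d) = [ pf d ]
premises (contr Θ Γ A d) = [ pf d ]
premises (weak Θ Γ A d) = [ pf d ]
premises (cut Θ Δ Γ A d₁ d₂) = pf d₁ ∷ pf d₂ ∷ []
premises (∧L₁ Θ Γ A B d) = [ pf d ]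
premises (∧L₂ Θ Γ A B d) = [ pf d ]
premises (∧R A B d₁ d₂) = pf d₁ ∷ pf d₂ ∷ []
premises (∨L Θ Γ A B d₁ d₂) = pf d₁ ∷ pf d₂ ∷ []
premises (∨R₁ A B d) = [ pf d ]
premises (∨R₂ A B d) = [ pf d ]
premises (⇒L Θ Δ Γ A B d₁ d₂) = pf d₁ ∷ pf d₂ ∷ []
premises (⇒R Γ A B d) = [ pf d ]

nth : {X : Set} → List X → ℕ → Maybe X
nth [] _ = nothing
nth (x ∷ xs) zero = just x
nth (x ∷ xs) (suc n) = nth xs n

subAt : Proof → List ℕ → Maybe Proof
subAt π [] = just π
subAt π (j ∷ p) with nth (premises (der π)) j
... | nothing = nothing
... | just ρ = subAt ρ p

-- Immediate ancestors of antecedent occurrences (positions counted from 0).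
-- localAnc d i = list of (premise index , position in that premise) which
-- are the immediate ancestors of the i-th antecedent formula of the
-- conclusion of the last rule of d.

localAnc : ∀ {Γ C} → Γ ⊢ C → ℕ → List (ℕ × ℕ)
localAnc (ax A) i = []
localAnc (exf A) i = []
localAnc (exch Δ Γ A B d) i =
  let n = length Δ in
  if i <ᵇ n then [ (0 , i) ]
  else if i ≡ᵇ n then [ (0 , suc n) ]
  else if i ≡ᵇ suc n then [ (0 , n) ]
  else [ (0 , i) ]
localAnc (contr Θ Γ A d) i =
  let n = length Θ in
  if i <ᵇ n then [ (0 , i) ]
  else if i ≡ᵇ n then (0 , n) ∷ (0 , suc n) ∷ []
  else [ (0 , suc i) ]
localAnc (weak Θ Γ A d) i =
  let n = length Θ in
  if i <ᵇ n then [ (0 , i) ]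
  else if i ≡ᵇ n then []
  else [ (0 , i ∸ 1) ]
localAnc (cut Θ Δ Γ A d₁ d₂) i =
  let n = length Θ ; m = length Δ in
  if i <ᵇ n then [ (1 , i) ]
  else if i <ᵇ n + m then [ (0 , i ∸ n) ]
  else [ (1 , suc (i ∸ m)) ]
localAnc (∧L₁ Θ Γ A B d) i =
  let n = length Θ in
  if i ≡ᵇ n then [] else [ (0 , i) ]
localAnc (∧L₂ Θ Γ A B d) i =
  let n = length Θ in
  if i ≡ᵇ n then [] else [ (0 , i) ]
localAnc (∧R A B d₁ d₂) i = (0 , i) ∷ (1 , i) ∷ []
localAnc (∨L Θ Γ A B d₁ d₂) i =
  let n = length Θ in
  if i ≡ᵇ n then [] else (0 , i) ∷ (1 , i) ∷ []
localAnc (∨R₁ A B d) i = [ (0 , i) ]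
localAnc (∨R₂ A B d) i = [ (0 , i) ]
localAnc (⇒L Θ Δ Γ A B d₁ d₂) i =
  let n = length Θ ; m = length Δ in
  if i <ᵇ n then [ (1 , i) ]
  else if i <ᵇ n + m then [ (0 , i ∸ n) ]
  else if i ≡ᵇ n + m then []
  else [ (1 , i ∸ m) ]
localAnc (⇒R Γ A B d) i = [ (0 , suc i) ]

-- An occurrence in a proof: (path to a node , position in its antecedent)
Occ : Set
Occ = List ℕ × ℕ

ImmAnc : Proof → Occ → Occ → Set
ImmAnc π (p , i) (p′ , i′) =
  Σ Proof λ ρ → subAt π p ≡ just ρ ×
  Σ ℕ λ j → (j , i′) ∈ localAnc (der ρ) i × p′ ≡ p ++ [ j ]

Cluster : Proof → Occ → Occ → Set
Cluster π = Star (ImmAnc π)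

isW : ∀ {Γ C} → Γ ⊢ C → Bool
isW (contr Θ Γ A d) = true
isW _ = false

isImpR : ∀ {Γ C} → Γ ⊢ C → Bool
isImpR (⇒R Γ A B d) = true
isImpR _ = false

IsW : Proof → Set
IsW π = T (isW (der π))

-- every rule strictly below the node at path p is (W)
-- (vacuous when p is the root, i.e. the last rule)
AllBelowW : Proof → List ℕ → Set
AllBelowW π p = ∀ q r → p ≡ q ++ r → r ≢ [] → ∀ ρ → subAt π q ≡ just ρ → IsW ρ

UpperI : Proof → List ℕ → Set
UpperI π p =
  Σ (List ℕ) λ q → p ≡ q ++ [ 0 ] ×
  Σ Proof λ ρl → subAt π q ≡ just ρl × IsW ρl ×
  Σ Proof λ ρ → subAt π p ≡ just ρ ×
  Σ Proof λ ρu → subAt π (p ++ [ 0 ]) ≡ just ρu ×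
  ∃ λ Θ → ∃ λ Γ → ∃ λ A →
    ant ρu ≡ Θ ++ A ∷ A ∷ A ∷ Γ × ant ρ ≡ Θ ++ A ∷ A ∷ Γ × ant ρl ≡ Θ ++ A ∷ Γ

UpperII : Proof → List ℕ → Set
UpperII π p =
  Σ (List ℕ) λ q → p ≡ q ++ [ 0 ] ×
  Σ Proof λ ρl → subAt π q ≡ just ρl × T (isImpR (der ρl)) ×
  Σ Proof λ ρ → subAt π p ≡ just ρ ×
  Σ Proof λ ρu → subAt π (p ++ [ 0 ]) ≡ just ρu ×
  ∃ λ Γ → ∃ λ A →
    ant ρu ≡ A ∷ A ∷ Γ × ant ρ ≡ A ∷ Γ × ant ρl ≡ Γ × con ρl ≡ A ⇒ con ρ

WNormal : Proof → Set
WNormal π = ∀ p ρ → subAt π p ≡ just ρ → IsW ρ →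
  AllBelowW π p ⊎ UpperI π p ⊎ UpperII π p

Tailless : Proof → Set
Tailless π = WNormal π × ¬ IsW π

data ExchSeq (σ : Proof) : Proof → Set where
  done : ExchSeq σ σ
  step : ∀ Δ Γ A B {C} (d : Δ ++ A ∷ B ∷ Γ ⊢ C) →
         ExchSeq σ (pf d) → ExchSeq σ (pf (exch Δ Γ A B d))

NoClusterIn : Proof → Proof → ℕ → Set
NoClusterIn π₁ π i =
  ∀ q r k → Cluster π ([] , i) (q ++ r , k) → subAt π q ≢ just π₁

data InC (π₁ π₂ : Proof) : Proof → Set where
  base : InC π₁ π₂ π₂
  cutC : ∀ {Θ Δ Γ A B} (d₁ : Δ ⊢ A) (d₂ : Θ ++ A ∷ Γ ⊢ B) {ρ} →
         pf d₁ ≡ π₁ → InC π₁ π₂ (pf d₂) →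
         NoClusterIn π₁ (pf d₂) (length Θ) →
         ExchSeq (pf (cut Θ Δ Γ A d₁ d₂)) ρ → InC π₁ π₂ ρ
  wC   : ∀ {Θ Γ A C} (d : Θ ++ A ∷ A ∷ Γ ⊢ C) →
         InC π₁ π₂ (pf d) → InC π₁ π₂ (pf (contr Θ Γ A d))

{-# OPTIONS --safe #-}
-- A proof in C(π₁, π₂) is π₂ with copies of π₁ cut in, interleaved with
-- exchanges and contractions.  All contractions can be moved to the end: an
-- exchange commutes with them up to permuting blocks of copies, and a cut on
-- a formula contracted from k + 1 copies becomes k + 1 cuts with π₁ on the
-- same cut formula (so the degree is unchanged), the resulting copies of the
-- antecedent of π₁ being sorted into blocks by exchanges.  Thus every such proof
-- has a tailless proof of the same degree whose antecedent repeats each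
-- formula of the original one in a block, and contracting the blocks by a
-- final run of (W) is W-normal.
module Submission where

open import Defs
open import Data.Product using (Σ; _×_)
open import Relation.Binary.PropositionalEquality using (_≡_)

open import Data.Empty using (⊥-elim)
open import Data.List using (List; []; _∷_; _++_; [_]; replicate; concat)
open import Data.List.Membership.Propositional using (_∈_)
open import Data.List.Properties using (++-assoc; ++-identityʳ)
open import Data.List.Relation.Binary.Permutation.Propositional
  using (_↭_; prep; swap) renaming (refl to ↭-refl; trans to ↭-trans)
import Data.List.Relation.Binary.Permutation.Propositional.Properties as ↭
open import Data.List.Relation.Unary.All as All using (All; []; _∷_)
open import Data.List.Relation.Unary.All.Properties using (concat⁺; replicate⁺)
open import Data.List.Relation.Unary.Any using (here; there)
open import Data.Maybe using (just; nothing)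
open import Data.Nat using (ℕ; zero; suc; _⊔_)
open import Data.Nat.Properties using (⊔-assoc; ⊔-idem)
open import Data.Product using (_,_; ∃-syntax)
open import Data.Sum using (_⊎_; inj₁; inj₂)
open import Relation.Nullary using (¬_)
open import Relation.Binary.PropositionalEquality
  using (refl; sym; trans; cong; cong₂)

All-nth : ∀ {X : Set} {P : X → Set} {xs x} j → All P xs → nth xs j ≡ just x → P x
All-nth zero    (px ∷ _)   refl = px
All-nth (suc j) (_ ∷ pxs) eq   = All-nth j pxs eq

subAt-∷ : ∀ π {j σ} → nth (premises (der π)) j ≡ just σ →
  ∀ p → subAt π (j ∷ p) ≡ subAt σ p
subAt-∷ π eq p rewrite eq = refl

subAt-∷⁻ : ∀ π j p {ρ} → subAt π (j ∷ p) ≡ just ρ →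
  ∃[ σ ] nth (premises (der π)) j ≡ just σ × subAt σ p ≡ just ρ
subAt-∷⁻ π j p eq with nth (premises (der π)) j
subAt-∷⁻ π j p eq | just σ = σ , refl , eq
subAt-∷⁻ π j p () | nothing

AllBelowW-root : ∀ π → AllBelowW π []
AllBelowW-root π []      r e  r≢[] = ⊥-elim (r≢[] (sym e))
AllBelowW-root π (_ ∷ _) r () _

AllBelowW⇒IsW-root : ∀ σ {p ρ} → subAt σ p ≡ just ρ → IsW ρ → AllBelowW σ p → IsW σ
AllBelowW⇒IsW-root σ {[]}    refl w _   = w
AllBelowW⇒IsW-root σ {j ∷ p} _    _ all = all [] (j ∷ p) refl (λ ()) σ refl

module _ π {j σ} (subAt-σ : ∀ p → subAt π (j ∷ p) ≡ subAt σ p) where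

  AllBelowW-∷ : IsW π → ∀ {p} → AllBelowW σ p → AllBelowW π (j ∷ p)
  AllBelowW-∷ w all []      r refl _    ρ refl = w
  AllBelowW-∷ w all (_ ∷ q) r refl r≢[] ρ eq   = all q r refl r≢[] ρ (trans (sym (subAt-σ q)) eq)

  UpperI-∷ : ∀ {p} → UpperI σ p → UpperI π (j ∷ p)
  UpperI-∷ {p} (q , refl , ρl , ql , wl , ρ , pρ , ρu , pu , rest) =
    j ∷ q , refl , ρl , trans (subAt-σ q) ql , wl , ρ , trans (subAt-σ p) pρ ,
    ρu , trans (subAt-σ (p ++ [ 0 ])) pu , rest

  UpperII-∷ : ∀ {p} → UpperII σ p → UpperII π (j ∷ p)
  UpperII-∷ {p} (q , refl , ρl , ql , wl , ρ , pρ , ρu , pu , rest) =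
    j ∷ q , refl , ρl , trans (subAt-σ q) ql , wl , ρ , trans (subAt-σ p) pρ ,
    ρu , trans (subAt-σ (p ++ [ 0 ])) pu , rest

WNormal-node : ∀ π → All (λ σ → WNormal σ × (IsW π ⊎ ¬ IsW σ)) (premises (der π)) →
  WNormal π
WNormal-node π hs []      ρ _  _ = inj₁ (AllBelowW-root π)
WNormal-node π hs (j ∷ p) ρ eq w with subAt-∷⁻ π j p eq
... | σ , σ-eq , ρ-eq with All-nth j hs σ-eq
... | wn , side with wn p ρ ρ-eq w | side
... | inj₂ (inj₁ u) | _       = inj₂ (inj₁ (UpperI-∷ π (subAt-∷ π σ-eq) u))
... | inj₂ (inj₂ u) | _       = inj₂ (inj₂ (UpperII-∷ π (subAt-∷ π σ-eq) u))
... | inj₁ all      | inj₁ wπ = inj₁ (AllBelowW-∷ π (subAt-∷ π σ-eq) wπ all)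
... | inj₁ all      | inj₂ ¬w = ⊥-elim (¬w (AllBelowW⇒IsW-root σ ρ-eq w all))

TaillessDerivation : ℕ → List Form → Form → Set
TaillessDerivation n Γ C = Σ (Γ ⊢ C) λ d → Tailless (pf d) × degree d ≡ n

WNormalDerivation : ℕ → List Form → Form → Set
WNormalDerivation n Γ C = Σ (Γ ⊢ C) λ d → WNormal (pf d) × degree d ≡ n

castᵗ : ∀ {n n′ Γ Γ′ C} → n ≡ n′ → Γ ≡ Γ′ → TaillessDerivation n Γ C → TaillessDerivation n′ Γ′ C
castᵗ refl refl d = d

castʷ : ∀ {n Γ Γ′ C} → Γ ≡ Γ′ → WNormalDerivation n Γ C → WNormalDerivation n Γ′ C
castʷ refl d = d

exch-tailless : ∀ {n C} Δ Γ A B →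
  TaillessDerivation n (Δ ++ A ∷ B ∷ Γ) C → TaillessDerivation n (Δ ++ B ∷ A ∷ Γ) C
exch-tailless Δ Γ A B (d , (wn , ¬w) , deg) =
  exch Δ Γ A B d , (WNormal-node _ ((wn , inj₂ ¬w) ∷ []) , λ ()) , deg

cut-tailless : ∀ {m n C} Θ Δ Γ A → TaillessDerivation m Δ A →
  TaillessDerivation n (Θ ++ A ∷ Γ) C → TaillessDerivation (size A ⊔ m ⊔ n) (Θ ++ Δ ++ Γ) C
cut-tailless Θ Δ Γ A (d₁ , (wn₁ , ¬w₁) , deg₁) (d₂ , (wn₂ , ¬w₂) , deg₂) =
  cut Θ Δ Γ A d₁ d₂ ,
  (WNormal-node _ ((wn₁ , inj₂ ¬w₁) ∷ (wn₂ , inj₂ ¬w₂) ∷ []) , λ ()) ,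
  cong₂ (λ m n → size A ⊔ m ⊔ n) deg₁ deg₂

contr-wnormal : ∀ {n C} Θ Γ A →
  WNormalDerivation n (Θ ++ A ∷ A ∷ Γ) C → WNormalDerivation n (Θ ++ A ∷ Γ) C
contr-wnormal Θ Γ A (d , wn , deg) = contr Θ Γ A d , WNormal-node _ ((wn , inj₁ _) ∷ []) , deg

exch-↭ : ∀ {n C Γ₁ Γ₂} Θ → Γ₁ ↭ Γ₂ →
  TaillessDerivation n (Θ ++ Γ₁) C → TaillessDerivation n (Θ ++ Γ₂) C
exch-↭ Θ ↭-refl d = d
exch-↭ {Γ₁ = _ ∷ Γ₁} {_ ∷ Γ₂} Θ (prep x p) d =
  castᵗ refl (++-assoc Θ [ x ] Γ₂)
    (exch-↭ (Θ ++ [ x ]) p (castᵗ refl (sym (++-assoc Θ [ x ] Γ₁)) d))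
exch-↭ {Γ₁ = _ ∷ _ ∷ Γ₁} {_ ∷ _ ∷ Γ₂} Θ (swap x y p) d =
  castᵗ refl (++-assoc Θ (y ∷ x ∷ []) Γ₂)
    (exch-↭ (Θ ++ y ∷ x ∷ []) p
      (castᵗ refl (sym (++-assoc Θ (y ∷ x ∷ []) Γ₁)) (exch-tailless Θ Γ₁ x y d)))
exch-↭ Θ (↭-trans p q) d = exch-↭ Θ q (exch-↭ Θ p d)

⊔-absorbs-⊔ : ∀ a b → a ⊔ (a ⊔ b) ≡ a ⊔ b
⊔-absorbs-⊔ a b = trans (sym (⊔-assoc a a b)) (cong (_⊔ b) (⊔-idem a))

cut-replicate : ∀ {m n C Θ Δ Γ A} k → TaillessDerivation m Δ A →
  TaillessDerivation n (Θ ++ replicate (suc k) A ++ Γ) C →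
  TaillessDerivation (size A ⊔ m ⊔ n) (Θ ++ concat (replicate (suc k) Δ) ++ Γ) C
cut-replicate {Θ = Θ} {Δ} {Γ} {A} zero d₁ d =
  castᵗ refl (cong (λ Δ′ → Θ ++ Δ′ ++ Γ) (sym (++-identityʳ Δ))) (cut-tailless Θ Δ Γ A d₁ d)
cut-replicate {m} {n} {Θ = Θ} {Δ} {Γ} {A} (suc k) d₁ d =
  castᵗ (⊔-absorbs-⊔ (size A ⊔ m) n)
    (trans (++-assoc Θ Δ (Δs ++ Γ)) (cong (Θ ++_) (sym (++-assoc Δ Δs Γ))))
    (cut-replicate k d₁
      (castᵗ refl (sym (++-assoc Θ Δ _)) (cut-tailless Θ Δ (replicate (suc k) A ++ Γ) A d₁ d)))
  where Δs = concat (replicate (suc k) Δ)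

-- Γ′ ≽ Γ : Γ′ is Γ with each formula replaced by a nonempty block of copies of it.
infix 4 _≽_ _≽↭_

data _≽_ : List Form → List Form → Set where
  []   : [] ≽ []
  keep : ∀ {A Γ′ Γ} → Γ′ ≽ Γ → A ∷ Γ′ ≽ A ∷ Γ
  copy : ∀ {A Γ′ Γ} → Γ′ ≽ A ∷ Γ → A ∷ Γ′ ≽ A ∷ Γ

_≽↭_ : List Form → List Form → Set
Γ ≽↭ Δ = ∃[ Γ′ ] Γ′ ≽ Δ × Γ ↭ Γ′

≽-refl : ∀ Γ → Γ ≽ Γ
≽-refl []      = []
≽-refl (_ ∷ Γ) = keep (≽-refl Γ)

≽-contract : ∀ Θ {A Γ Γ′} → Γ′ ≽ Θ ++ A ∷ A ∷ Γ → Γ′ ≽ Θ ++ A ∷ Γ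
≽-contract []      (keep e) = copy e
≽-contract []      (copy e) = copy (≽-contract [] e)
≽-contract (_ ∷ Θ) (keep e) = keep (≽-contract Θ e)
≽-contract (_ ∷ Θ) (copy e) = copy (≽-contract (_ ∷ Θ) e)

≽-++ : ∀ {Θ′ Θ Γ′ Γ} → Θ′ ≽ Θ → Γ′ ≽ Γ → Θ′ ++ Γ′ ≽ Θ ++ Γ
≽-++ []       e = e
≽-++ (keep f) e = keep (≽-++ f e)
≽-++ (copy f) e = copy (≽-++ f e)

≽-++⁻ : ∀ Θ {Γ Γ′} → Γ′ ≽ Θ ++ Γ → ∃[ Θ′ ] ∃[ Γ″ ] Γ′ ≡ Θ′ ++ Γ″ × Θ′ ≽ Θ × Γ″ ≽ Γ
≽-++⁻ []      e = [] , _ , refl , [] , e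
≽-++⁻ (A ∷ Θ) (keep e) with ≽-++⁻ Θ e
... | Θ′ , Γ″ , refl , f , g = A ∷ Θ′ , Γ″ , refl , keep f , g
≽-++⁻ (A ∷ Θ) (copy e) with ≽-++⁻ (A ∷ Θ) e
... | Θ′ , Γ″ , refl , f , g = A ∷ Θ′ , Γ″ , refl , copy f , g

≽-∷⁻ : ∀ {A Γ Γ′} → Γ′ ≽ A ∷ Γ → ∃[ k ] ∃[ G ] Γ′ ≡ replicate (suc k) A ++ G × G ≽ Γ
≽-∷⁻ (keep e) = 0 , _ , refl , e
≽-∷⁻ (copy e) with ≽-∷⁻ e
... | k , G , refl , g = suc k , G , refl , g

≽-replicate : ∀ {A G Γ} k → G ≽ Γ → replicate (suc k) A ++ G ≽ A ∷ Γ
≽-replicate zero    e = keep e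
≽-replicate (suc k) e = copy (≽-replicate k e)

≽-↭ : ∀ {Γ₁ Γ₂ Γ′} → Γ₁ ↭ Γ₂ → Γ′ ≽ Γ₁ → Γ′ ≽↭ Γ₂
≽-↭ ↭-refl e = _ , e , ↭-refl
≽-↭ (prep x p) (keep e) with ≽-↭ p e
... | G , f , q = x ∷ G , keep f , prep x q
≽-↭ p@(prep x _) (copy e) with ≽-↭ p e
... | G , f , q = x ∷ G , copy f , prep x q
≽-↭ (swap x y p) e with ≽-∷⁻ e
... | a , _ , refl , e₁ with ≽-∷⁻ e₁
... | b , _ , refl , e₂ with ≽-↭ p e₂
... | G , f , q =
  replicate (suc b) y ++ replicate (suc a) x ++ G ,
  ≽-replicate b (≽-replicate a f) ,
  ↭-trans (↭.++⁺ˡ (replicate (suc a) x) (↭.++⁺ˡ (replicate (suc b) y) q))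
          (↭.shifts (replicate (suc a) x) (replicate (suc b) y))
≽-↭ (↭-trans p q) e with ≽-↭ p e
... | G , f , r with ≽-↭ q f
... | G′ , f′ , r′ = G′ , f′ , ↭-trans r r′

≽-insert : ∀ {x Γ G} → x ∈ Γ → G ≽ Γ → x ∷ G ≽↭ Γ
≽-insert (here refl) (keep e) = _ , copy (keep e) , ↭-refl
≽-insert (there x∈Γ) (keep {A = y} e) with ≽-insert x∈Γ e
... | G , f , q = y ∷ G , keep f , ↭-trans (swap _ y ↭-refl) (prep y q)
≽-insert x∈Γ (copy {A = y} e) with ≽-insert x∈Γ e
... | G , f , q = y ∷ G , copy f , ↭-trans (swap _ y ↭-refl) (prep y q)

≽-absorb : ∀ {Γ G J} → All (_∈ Γ) J → G ≽ Γ → J ++ G ≽↭ Γ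
≽-absorb []            e = _ , e , ↭-refl
≽-absorb (x∈Γ ∷ J⊆Γ) e with ≽-absorb J⊆Γ e
... | G₁ , f₁ , q₁ with ≽-insert x∈Γ f₁
... | G₂ , f₂ , q₂ = G₂ , f₂ , ↭-trans (prep _ q₁) q₂

concat-replicate-≽↭ : ∀ k Δ → concat (replicate (suc k) Δ) ≽↭ Δ
concat-replicate-≽↭ k Δ =
  let G , f , q = ≽-absorb Δs⊆Δ (≽-refl Δ) in G , f , ↭-trans (↭.++-comm Δ _) q
  where Δs⊆Δ : All (_∈ Δ) (concat (replicate k Δ))
        Δs⊆Δ = concat⁺ (replicate⁺ k (All.tabulate (λ x∈Δ → x∈Δ)))

contract-≽ : ∀ {n C Γ′ Γ} Θ → Γ′ ≽ Γ →
  WNormalDerivation n (Θ ++ Γ′) C → WNormalDerivation n (Θ ++ Γ) C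
contract-≽ Θ [] d = d
contract-≽ Θ (keep {A} {Γ′} {Γ} e) d =
  castʷ (++-assoc Θ [ A ] Γ)
    (contract-≽ (Θ ++ [ A ]) e (castʷ (sym (++-assoc Θ [ A ] Γ′)) d))
contract-≽ Θ (copy {A} {Γ′} {Γ} e) d =
  contr-wnormal Θ Γ A (castʷ (++-assoc Θ [ A ] (A ∷ Γ))
    (contract-≽ (Θ ++ [ A ]) e (castʷ (sym (++-assoc Θ [ A ] Γ′)) d)))

TaillessForm : Proof → Set
TaillessForm π = ∃[ Γ′ ] Γ′ ≽ ant π × TaillessDerivation (degree (der π)) Γ′ (con π)

TaillessForm-exch : ∀ {σ ρ} → ExchSeq σ ρ → TaillessForm σ → TaillessForm ρ
TaillessForm-exch done t = t
TaillessForm-exch (step Δ Γ A B _ s) t =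
  let _ , e , d = TaillessForm-exch s t
      Γ′ , f , q = ≽-↭ (↭.++⁺ˡ Δ (swap A B ↭-refl)) e
  in Γ′ , f , exch-↭ [] q d

TaillessForm-cut : ∀ {Θ Δ Γ A C} (d₁ : Δ ⊢ A) (d₂ : Θ ++ A ∷ Γ ⊢ C) →
  Tailless (pf d₁) → TaillessForm (pf d₂) → TaillessForm (pf (cut Θ Δ Γ A d₁ d₂))
TaillessForm-cut {Θ} {Δ} d₁ d₂ t₁ (_ , e , d) with ≽-++⁻ Θ e
... | Θ′ , _ , refl , eΘ , eAΓ with ≽-∷⁻ eAΓ
... | k , G , refl , eΓ with concat-replicate-≽↭ k Δ
... | D , eΔ , q =
  Θ′ ++ D ++ G , ≽-++ eΘ (≽-++ eΔ eΓ) ,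
  exch-↭ Θ′ (↭.++⁺ʳ G q) (cut-replicate k (d₁ , t₁ , refl) d)

taillessForm : ∀ {π₁ π₂ π} → Tailless π₁ → Tailless π₂ → InC π₁ π₂ π → TaillessForm π
taillessForm {π₂ = π₂} _ t₂ base = ant π₂ , ≽-refl (ant π₂) , der π₂ , t₂ , refl
taillessForm t₁ t₂ (cutC d₁ d₂ refl c _ s) =
  TaillessForm-exch s (TaillessForm-cut d₁ d₂ t₁ (taillessForm t₁ t₂ c))
taillessForm t₁ t₂ (wC {Θ} _ c) =
  let Γ′ , e , d = taillessForm t₁ t₂ c in Γ′ , ≽-contract Θ e , d

lemma5p2 : (π₁ π₂ : Proof) → Tailless π₁ → Tailless π₂ →
    (π : Proof) → InC π₁ π₂ π →
    Σ (ant π ⊢ con π) λ d → WNormal (pf d) × degree d ≡ degree (der π)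
lemma5p2 _ _ t₁ t₂ _ c =
  let Γ′ , e , d , (wn , _) , deg = taillessForm t₁ t₂ c in contract-≽ [] e (d , wn , deg)
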